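{- Fix an integer $H>0$. If $t\vdash^* t'$ and $x$ is a heavy node of $t$ (respectively, a basket node of $t$), then $x$ is a heavy node (respectively, a basket node) of $t'$ as well. Consequently, if $x$ is light in $t'$, then $x$ is light in $t$.
   Context: A tree is $t=(V_t,\mathrm{root}_t,\mathrm{parent}_t)$ with finite node set $V_t$, root $\mathrm{root}_t$, and parent map on non-root nodes such that iterating it from any node reaches the root. $x\preceq_t y$ means $x=\mathrm{parent}_t^k(y)$ for some $k\ge 0$; $\mathrm{size}(t,x)=|\{y:x\preceq_t y\}|$. For distinct siblings $x\ne y$ in $t$, $\mathrm{push}(t,x,y)$ is the tree with the same nodes and root where the parent of $x$ becomes $y$, other parents unchanged. $t\vdash t'$ means $t'=\mathrm{push}(t,x,y)$ for some such $x,y$; $\vdash^*$ is its reflexive-transitive closure. Given $H$: a node $x$ of $t$ is light if $\mathrm{size}(t,x)\le H$, heavy if $\mathrm{size}(t,x)>H$, and a basket if it has a heavy child. -}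

module Defs where

open import Data.Nat using (ℕ; zero; suc; _≤_; _<_)
open import Data.Fin using (Fin)
open import Data.Fin.Subset using (Subset; _∈_; ∣_∣)
open import Data.Maybe using (Maybe; just; nothing; _>>=_)
open import Data.Product using (Σ; ∃; ∃-syntax; _×_; _,_)
open import Relation.Binary.PropositionalEquality using (_≡_; _≢_)
open import Function.Bundles using (_⇔_)
open import Relation.Binary.Construct.Closure.ReflexiveTransitive using (Star)

iterParent : {n : ℕ} → (Fin n → Maybe (Fin n)) → ℕ → Fin n → Maybe (Fin n)
iterParent par zero    x = just x
iterParent par (suc k) x = iterParent par k x >>= par

record Tree (n : ℕ) : Set where
  field
    root        : Fin n
    parent      : Fin n → Maybe (Fin n)
    root-parent : parent root ≡ nothing
    has-parent  : ∀ x → x ≢ root → ∃[ p ] parent x ≡ just p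
    reaches     : ∀ x → ∃[ k ] iterParent parent k x ≡ just root
open Tree public

_⊢_⪯_ : {n : ℕ} → Tree n → Fin n → Fin n → Set
t ⊢ x ⪯ y = ∃[ k ] iterParent (parent t) k y ≡ just x

-- size(t,x) = m : the subset {y | x ⪯_t y} has cardinality m.
-- (The subset S with  y ∈ S ⇔ x ⪯ y  is unique, so this is the size.)
IsSubtree : {n : ℕ} → Tree n → Fin n → Subset n → Set
IsSubtree t x S = ∀ y → (y ∈ S) ⇔ (t ⊢ x ⪯ y)

Light : {n : ℕ} → ℕ → Tree n → Fin n → Set
Light H t x = ∃[ S ] (IsSubtree t x S × ∣ S ∣ ≤ H)

Heavy : {n : ℕ} → ℕ → Tree n → Fin n → Set
Heavy H t x = ∃[ S ] (IsSubtree t x S × H < ∣ S ∣)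

Basket : {n : ℕ} → ℕ → Tree n → Fin n → Set
Basket H t x = ∃[ c ] (parent t c ≡ just x × Heavy H t c)

Siblings : {n : ℕ} → Tree n → Fin n → Fin n → Set
Siblings t x y = x ≢ y × ∃[ p ] (parent t x ≡ just p × parent t y ≡ just p)

IsPush : {n : ℕ} → Tree n → Fin n → Fin n → Tree n → Set
IsPush t x y t' =
  root t' ≡ root t × parent t' x ≡ just y × (∀ z → z ≢ x → parent t' z ≡ parent t z)

_⊢₁_ : {n : ℕ} → Tree n → Tree n → Set
t ⊢₁ t' = ∃[ x ] ∃[ y ] (Siblings t x y × IsPush t x y t')

_⊢*_ : {n : ℕ} → Tree n → Tree n → Set
_⊢*_ = Star _⊢₁_

module Submission where

-- Pushing x onto its sibling y only lengthens the path from x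
-- to its old parent p (x → y → p); every ancestry relation a ⪯ w of the old
-- tree survives in the new one.  Since size(t,a) counts the descendants of
-- a, sizes can only grow along ⊢*, which gives the statements about heavy
-- and light nodes.  For baskets: a heavy child c of x stays a heavy child
-- of x unless c is the pushed node, in which case its new parent y is a
-- child of x whose subtree contains the (still heavy) subtree of c.

open import Defs
open import Data.Nat using (ℕ; zero; suc; _+_; _∸_; _≤_; _<_; _≤?_; s≤s)
open import Data.Nat.Properties using (≤-trans; <-≤-trans; ≰⇒>; m∸n+n≡m; m<n⇒0<n∸m; <⇒≤; 0<1+n; anyUpTo?)
open import Data.Fin using (Fin; _≟_)
open import Data.Fin.Subset using (Subset; _∈_; ∣_∣)
open import Data.Fin.Subset.Properties using (p⊆q⇒∣p∣≤∣q∣)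
open import Data.Vec using (tabulate)
open import Data.Vec.Properties using (lookup∘tabulate; []=⇒lookup; lookup⇒[]=)
open import Data.Bool using (true)
open import Data.Maybe using (Maybe; just; nothing; _>>=_)
import Data.Maybe.Properties as Maybe
open import Data.Product using (Σ; _×_; _,_)
open import Relation.Nullary using (Dec; yes; no; does; proof; contradiction)
open import Relation.Nullary.Reflects using (Reflects; invert)
open import Relation.Nullary.Decidable using (dec-true)
open import Relation.Binary.PropositionalEquality using (_≡_; refl; sym; trans; cong; subst; ≢-sym)
open import Function.Bundles using (_⇔_; mk⇔; Equivalence)
open import Relation.Binary.Construct.Closure.ReflexiveTransitive using (ε; _◅_)

private
  variable
    n : ℕ

iterParent-+ : (par : Fin n → Maybe (Fin n)) (m : ℕ) {k : ℕ} {x z : Fin n}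
  → iterParent par k x ≡ just z → iterParent par (m + k) x ≡ iterParent par m z
iterParent-+ par zero    e = e
iterParent-+ par (suc m) e = cong (_>>= par) (iterParent-+ par m e)

iterParent-top : (par : Fin n → Maybe (Fin n)) {r : Fin n} → par r ≡ nothing
  → ∀ m → 0 < m → iterParent par m r ≡ nothing
iterParent-top par top (suc zero)    _ = top
iterParent-top par top (suc (suc m)) _ =
  cong (_>>= par) (iterParent-top par top (suc m) 0<1+n)

walk-bounded : (par : Fin n → Maybe (Fin n)) {r x y : Fin n} {k₀ : ℕ}
  → iterParent par k₀ y ≡ just r → par r ≡ nothing
  → ∀ k → iterParent par k y ≡ just x → k ≤ k₀
walk-bounded par {y = y} {k₀ = k₀} reach top k walk with k ≤? k₀
... | yes k≤k₀ = k≤k₀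
... | no  k≰k₀ = contradiction (trans (sym past-top) walk) λ ()
  where
  k₀<k : k₀ < k
  k₀<k = ≰⇒> k≰k₀
  past-top : iterParent par k y ≡ nothing
  past-top =
    trans (cong (λ j → iterParent par j y) (sym (m∸n+n≡m (<⇒≤ k₀<k))))
          (trans (iterParent-+ par (k ∸ k₀) reach)
                 (iterParent-top par top (k ∸ k₀) (m<n⇒0<n∸m k₀<k)))

⪯-trans : (t : Tree n) {a b c : Fin n} → t ⊢ a ⪯ b → t ⊢ b ⪯ c → t ⊢ a ⪯ c
⪯-trans t (m , b→a) (k , c→b) = m + k , trans (iterParent-+ (parent t) m c→b) b→a

-- Ancestry is decidable: only walks no longer than the path to the root matter.
⪯-dec : (t : Tree n) (x y : Fin n) → Dec (t ⊢ x ⪯ y)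
⪯-dec t x y with reaches t y
... | k₀ , reach with anyUpTo? (λ k → Maybe.≡-dec _≟_ (iterParent (parent t) k y) (just x)) (suc k₀)
... | yes (k , _ , walk) = yes (k , walk)
... | no  no-short-walk  = no λ (k , walk) →
      no-short-walk (k , s≤s (walk-bounded (parent t) reach (root-parent t) k walk) , walk)

decidable⇒subset : {P : Fin n → Set} → (∀ y → Dec (P y))
  → Σ (Subset n) λ S → ∀ y → (y ∈ S) ⇔ P y
decidable⇒subset {P = P} P? = S , λ y → mk⇔ (member⇒P y) (P⇒member y)
  where
  S = tabulate (λ y → does (P? y))
  member⇒P : ∀ y → y ∈ S → P y
  member⇒P y y∈S = invert (subst (Reflects (P y)) does-true (proof (P? y)))
    where
    does-true : does (P? y) ≡ true
    does-true = trans (sym (lookup∘tabulate _ y)) ([]=⇒lookup y∈S)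
  P⇒member : ∀ y → P y → y ∈ S
  P⇒member y Py = lookup⇒[]= y S (trans (lookup∘tabulate _ y) (dec-true (P? y) Py))

-- Every node has a subtree set, so size(t,x) is always defined.
subtree : (t : Tree n) (x : Fin n) → Σ (Subset n) (IsSubtree t x)
subtree t x = decidable⇒subset (⪯-dec t x)

size-≤ : (t t' : Tree n) {a b : Fin n} {S S' : Subset n}
  → (∀ {y} → t ⊢ b ⪯ y → t' ⊢ a ⪯ y) → IsSubtree t b S → IsSubtree t' a S'
  → ∣ S ∣ ≤ ∣ S' ∣
size-≤ t t' below S-sub S'-sub = p⊆q⇒∣p∣≤∣q∣ λ {y} y∈S →
  Equivalence.from (S'-sub y) (below (Equivalence.to (S-sub y) y∈S))

heavy-grows : (H : ℕ) (t t' : Tree n) {a b : Fin n}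
  → (∀ {y} → t ⊢ b ⪯ y → t' ⊢ a ⪯ y) → Heavy H t b → Heavy H t' a
heavy-grows H t t' {a = a} below (S , S-sub , H<∣S∣) with subtree t' a
... | S' , S'-sub = S' , S'-sub , <-≤-trans H<∣S∣ (size-≤ t t' below S-sub S'-sub)

light-shrinks : (H : ℕ) (t t' : Tree n) {a b : Fin n}
  → (∀ {y} → t ⊢ b ⪯ y → t' ⊢ a ⪯ y) → Light H t' a → Light H t b
light-shrinks H t t' {b = b} below (S' , S'-sub , ∣S'∣≤H) with subtree t b
... | S , S-sub = S , S-sub , ≤-trans (size-≤ t t' below S-sub S'-sub) ∣S'∣≤H

heavy-ancestor : (H : ℕ) (t : Tree n) {a b : Fin n} → t ⊢ a ⪯ b → Heavy H t b → Heavy H t a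
heavy-ancestor H t a⪯b = heavy-grows H t t (⪯-trans t a⪯b)

_⊑_ : Tree n → Tree n → Set
t ⊑ t' = ∀ {a w} → t ⊢ a ⪯ w → t' ⊢ a ⪯ w

edges⇒⊑ : {t t' : Tree n} → (∀ {a z} → parent t z ≡ just a → t' ⊢ a ⪯ z) → t ⊑ t'
edges⇒⊑ {t = t} {t' = t'} edge {w = w} (k , walk) = along k walk
  where
  along : ∀ k {a} → iterParent (parent t) k w ≡ just a → t' ⊢ a ⪯ w
  along zero    walk = zero , walk
  along (suc k) walk with iterParent (parent t) k w in walk-k
  ... | just b = ⪯-trans t' (edge walk) (along k walk-k)

-- The edge u → p of the pushed node u becomes the path u → y → p;
-- all other edges are unchanged.
push-⊑ : (t t' : Tree n) → t ⊢₁ t' → t ⊑ t'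
push-⊑ t t' (u , y , (u≢y , p , pu , py) , (_ , pu' , unchanged)) = edges⇒⊑ {t = t} {t' = t'} edge
  where
  edge : ∀ {a z} → parent t z ≡ just a → t' ⊢ a ⪯ z
  edge {z = z} pz with z ≟ u
  ... | no  z≢u  = 1 , trans (unchanged z z≢u) pz
  ... | yes refl = 2 , trans (cong (_>>= parent t') pu')
                         (trans (unchanged y (≢-sym u≢y)) (trans py (trans (sym pu) pz)))

⊢*-⊑ : {t t' : Tree n} → t ⊢* t' → t ⊑ t'
⊢*-⊑ ε                             = λ a⪯w → a⪯w
⊢*-⊑ {t = t} (_◅_ {j = t₁} step steps) = λ a⪯w → ⊢*-⊑ steps (push-⊑ t t₁ step a⪯w)

-- A heavy child c of x stays one, unless c is pushed onto its sibling y;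
-- then y is a child of x and, being an ancestor of c, is heavy.
push-basket : (H : ℕ) (t t' : Tree n) → t ⊢₁ t' → ∀ {x} → Basket H t x → Basket H t' x
push-basket H t t' step@(u , y , (u≢y , p , pu , py) , (_ , pu' , unchanged)) (c , pc , heavy-c)
  with c ≟ u
... | no  c≢u  = c , trans (unchanged c c≢u) pc , heavy-grows H t t' (push-⊑ t t' step) heavy-c
... | yes refl = y , trans (unchanged y (≢-sym u≢y)) (trans py (trans (sym pu) pc))
                   , heavy-ancestor H t' (1 , pu') (heavy-grows H t t' (push-⊑ t t' step) heavy-c)

⊢*-basket : (H : ℕ) {t t' : Tree n} → t ⊢* t' → ∀ {x} → Basket H t x → Basket H t' x
⊢*-basket H ε basket = basket
⊢*-basket H {t = t} (_◅_ {j = t₁} step steps) basket =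
  ⊢*-basket H steps (push-basket H t t₁ step basket)

proposition2 : (H : ℕ) → 0 < H → {n : ℕ} → (t t' : Tree n) → t ⊢* t' → (x : Fin n)
    → (Heavy H t x → Heavy H t' x) × (Basket H t x → Basket H t' x) × (Light H t' x → Light H t x)
proposition2 H _ t t' steps x =
    heavy-grows H t t' (⊢*-⊑ steps)
  , ⊢*-basket H steps
  , light-shrinks H t t' (⊢*-⊑ steps)
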